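{- Let $D,E,W,V$ be as defined in the context and $\lambda_n=\alpha\beta-\gamma\delta q^{n-1}$ for $n\ge1$. (a) If for every word $X$ in $D,E$ and all $j,\ell\ge0$ $$(WXDE)_{j,\ell}=q(WXED)_{j,\ell}+\alpha\beta(WX(D+E))_{j,\ell}-\gamma\delta q^{|X|+1}(WX(D+E))_{j-1,\ell},$$ then for all words $X,Y$ in $D,E$: $WX(DE-qED)YV=\lambda_{|X|+|Y|+2}\,WX(D+E)YV$. (b) If for every word $X$ in $D,E$ and all $j,\ell\ge0$ $$\beta(WXD)_{j,\ell}=\delta(WXE)_{j-1,\ell}+\alpha\beta(WX)_{j,\ell-1}-\gamma\delta q^{|X|}(WX)_{j-1,\ell-1},$$ then for all words $X$: $\beta WXDV-\delta WXEV=\lambda_{|X|+1}\,WXV$.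
   Context: Parameters $\alpha,\beta,\gamma,\delta,q$. For nonnegative integers $i,j,k,\ell$ define $D_{i,j,k,\ell}$ and $E_{i,j,k,\ell}$ recursively (any entry with a negative index is $0$): $D_{i,j,k,\ell}=0$ if $j<i$ or $\ell>k+1$; $=\delta q^i$ if $j=i+1$, $k=\ell=0$; $=\alpha q^i$ if $j=i$, $k=0$, $\ell=1$; otherwise $D_{i,j,k,\ell}=\delta(D_{i,j-1,k-1,\ell}+E_{i,j-1,k-1,\ell})+D_{i,j,k-1,\ell-1}$. $E_{i,j,k,\ell}=0$ if $j<i$ or $\ell>k+1$; $=\beta q^i$ if $j=i$, $k=\ell=0$; $=\gamma q^i$ if $j=i$, $k=0$, $\ell=1$; otherwise $E_{i,j,k,\ell}=\beta(D_{i,j,k-1,\ell}+E_{i,j,k-1,\ell})+qE_{i,j,k-1,\ell-1}$. Matrix products: $(MN)_{i,j,k,\ell}=\sum_{a,b}M_{i,a,k,b}N_{a,j,b,\ell}$; a word denotes the product (empty word = identity), $|X|$ its length. $W$: $W_{i,k}=1$ if $i=k=0$ else $0$, with $(WX)_{j,\ell}=\sum_{i,k}W_{i,k}X_{i,j,k,\ell}$; $V$: all entries $1$, so $WXV=\sum_{j,\ell}(WX)_{j,\ell}$ and $WXYV=\sum_{j,\ell}(WXY)_{j,\ell}$. Entries $(WX)_{j,\ell}$ with a negative index are $0$. -}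

module Defs where

open import Level using (Level)
open import Algebra.Bundles using (CommutativeRing)
open import Data.Nat as ℕ using (ℕ; zero; suc; _<ᵇ_; _≡ᵇ_)
open import Data.Bool using (Bool; true; false; if_then_else_; _∨_; _∧_)
open import Data.List using (List; []; _∷_; length)

data Letter : Set where
  𝐃 𝐄 : Letter

module Matrix {c ℓ' : Level} (R : CommutativeRing c ℓ') (α β γ δ q : CommutativeRing.Carrier R) where
  open CommutativeRing R public using (Carrier; _≈_; _+_; _*_; -_; 0#; 1#)

  infixl 6 _⊖_
  _⊖_ : Carrier → Carrier → Carrier
  x ⊖ y = x + (- y)

  pow : Carrier → ℕ → Carrier
  pow x zero    = 1#
  pow x (suc n) = x * pow x n

  ∑≤ : ℕ → (ℕ → Carrier) → Carrier
  ∑≤ zero    f = f zero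
  ∑≤ (suc n) f = ∑≤ n f + f (suc n)

  -- 4-index matrices D_{i,j,k,ℓ}, E_{i,j,k,ℓ}; all indices are naturals,
  -- entries with a negative index (j-1 or ℓ-1 at 0, or k-1 at k = 0) are 0.
  mutual
    Dm : ℕ → ℕ → ℕ → ℕ → Carrier
    Dm i j k l = if (j <ᵇ i) ∨ (suc k <ᵇ l) then 0# else Dcore i j k l

    Dcore : ℕ → ℕ → ℕ → ℕ → Carrier
    Dcore i j zero l =
      if (j ≡ᵇ suc i) ∧ (l ≡ᵇ 0) then δ * pow q i
      else if (j ≡ᵇ i) ∧ (l ≡ᵇ 1) then α * pow q i
      else 0#
    Dcore i j (suc k) l =
      δ * (DjPrev i j k l + EjPrev i j k l) + DlPrev i j k l

    DjPrev : ℕ → ℕ → ℕ → ℕ → Carrier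
    DjPrev i zero    k l = 0#
    DjPrev i (suc j) k l = Dm i j k l

    EjPrev : ℕ → ℕ → ℕ → ℕ → Carrier
    EjPrev i zero    k l = 0#
    EjPrev i (suc j) k l = Em i j k l

    DlPrev : ℕ → ℕ → ℕ → ℕ → Carrier
    DlPrev i j k zero    = 0#
    DlPrev i j k (suc l) = Dm i j k l

    Em : ℕ → ℕ → ℕ → ℕ → Carrier
    Em i j k l = if (j <ᵇ i) ∨ (suc k <ᵇ l) then 0# else Ecore i j k l

    Ecore : ℕ → ℕ → ℕ → ℕ → Carrier
    Ecore i j zero l =
      if (j ≡ᵇ i) ∧ (l ≡ᵇ 0) then β * pow q i
      else if (j ≡ᵇ i) ∧ (l ≡ᵇ 1) then γ * pow q i
      else 0#
    Ecore i j (suc k) l =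
      β * (Dm i j k l + Em i j k l) + q * ElPrev i j k l

    ElPrev : ℕ → ℕ → ℕ → ℕ → Carrier
    ElPrev i j k zero    = 0#
    ElPrev i j k (suc l) = Em i j k l

  mat : Letter → ℕ → ℕ → ℕ → ℕ → Carrier
  mat 𝐃 = Dm
  mat 𝐄 = Em

  -- Row vectors indexed by (j, ℓ).
  Row : Set c
  Row = ℕ → ℕ → Carrier

  Wrow : Row
  Wrow j l = if (j ≡ᵇ 0) ∧ (l ≡ᵇ 0) then 1# else 0#

  -- (v M)_{j,ℓ} = Σ_{a,b} v_{a,b} M_{a,j,b,ℓ}, for a row vector v whose
  -- entries vanish when the second index exceeds n.  Terms with a > j vanish
  -- since M_{a,j,b,ℓ} = 0 for j < a, so the sum is exactly the finite one below.
  step : ℕ → Row → (ℕ → ℕ → ℕ → ℕ → Carrier) → Row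
  step n v M j l = ∑≤ j (λ a → ∑≤ n (λ b → v a b * M a j b l))

  -- (W X) computed left to right; n = number of letters already applied
  -- (so entries with second index > n vanish).
  go : ℕ → Row → List Letter → Row
  go n v []       = v
  go n v (x ∷ xs) = go (suc n) (step n v (mat x)) xs

  WX : List Letter → Row
  WX X = go 0 Wrow X

  WXprev : List Letter → Row
  WXprev X zero    l = 0#
  WXprev X (suc j) l = WX X j l

  WXprev2 : List Letter → Row
  WXprev2 X zero    l       = 0#
  WXprev2 X (suc j) zero    = 0#
  WXprev2 X (suc j) (suc l) = WX X j l

  WXprevℓ : List Letter → Row
  WXprevℓ X j zero    = 0#
  WXprevℓ X j (suc l) = WX X j l

  -- W X V = Σ_{j,ℓ} (WX)_{j,ℓ}.  (WX)_{j,ℓ} = 0 unless ℓ ≤ |X| and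
  -- j ≤ |X|(|X|+1)/2, so summing over j, ℓ ≤ (|X|+1)² gives the full sum.
  WXV : List Letter → Carrier
  WXV X = ∑≤ N (λ j → ∑≤ N (λ l → WX X j l))
    where
    N : ℕ
    N = suc (length X) ℕ.* suc (length X)

  -- λ_n = αβ - γδ q^{n-1}   (used only for n ≥ 1)
  lam : ℕ → Carrier
  lam n = α * β ⊖ γ * δ * pow q (n ℕ.∸ 1)

-- natural-number addition under a name not clashing with ring addition
_+ᴺ_ : ℕ → ℕ → ℕ
_+ᴺ_ = ℕ._+_
infixl 6 _+ᴺ_

module Submission where

-- Right multiplication of a row by a letter is linear, and the matrices D, E
-- are invariant up to a factor q under the diagonal shift (i, j) ↦ (i+1, j+1); hence
-- multiplying by a letter commutes with the shift of the first row index up to a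
-- factor q.  So hypothesis (a), an identity of rows at the word X D E, remains an
-- identity of rows after appending any suffix Y, its shifted term gaining q^|Y|.
-- Applying ·V, the total sum of a row, which is linear and blind to shifts of either
-- index (all rows involved are finitely supported), yields (a); (b) needs no suffix.

open import Defs
open import Level using (Level)
open import Algebra.Bundles using (CommutativeRing)
open import Data.Nat as ℕ using (ℕ; zero; suc; _<ᵇ_; _≡ᵇ_; _≤_; _<_; _≤′_; s≤s; _<?_; _∸_)
import Data.Nat.Properties as NP
open import Data.Nat.Solver using (module +-*-Solver)
open import Data.Bool using (true; false; if_then_else_; _∨_; _∧_; T)
open import Data.List using (List; []; _∷_; _++_; length)
open import Data.List.Properties using (length-++; ++-assoc)
open import Data.Product using (_×_; _,_)
open import Data.Sum using (_⊎_; inj₁; inj₂)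
open import Data.Empty using (⊥-elim)
open import Relation.Nullary using (yes; no)
open import Relation.Binary.Bundles using (Setoid)
open import Relation.Binary.PropositionalEquality as Eq using (_≡_)
import Relation.Binary.Reasoning.Setoid as SetoidReasoning
import Algebra.Solver.Ring.NaturalCoefficients.Default

module Proof {c ℓ' : Level} (R : CommutativeRing c ℓ') (α β γ δ q : CommutativeRing.Carrier R) where
  open Matrix R α β γ δ q
  open CommutativeRing R
    using ( setoid; +-cong; *-cong; +-congˡ; +-congʳ; *-congˡ; *-congʳ
          ; +-identityˡ; +-identityʳ; *-identityˡ; zeroˡ; zeroʳ; distribˡ; distribʳ
          ; +-assoc; *-assoc; -‿cong; -‿inverseʳ
          ; +-commutativeSemigroup; *-commutativeSemigroup; commutativeSemiring; ring )
    renaming (refl to ≈-refl; sym to ≈-sym; trans to ≈-trans)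
  open import Algebra.Properties.Ring ring using (-‿distribˡ-*)
  open import Algebra.Properties.CommutativeSemigroup +-commutativeSemigroup using (interchange)
  open import Algebra.Properties.CommutativeSemigroup *-commutativeSemigroup using (x∙yz≈y∙xz)
  module SemiringSolver = Algebra.Solver.Ring.NaturalCoefficients.Default commutativeSemiring
  module ≈-Reasoning = SetoidReasoning setoid

  ∑-cong : ∀ n {f g : ℕ → Carrier} → (∀ i → f i ≈ g i) → ∑≤ n f ≈ ∑≤ n g
  ∑-cong zero    f≈g = f≈g 0
  ∑-cong (suc n) f≈g = +-cong (∑-cong n f≈g) (f≈g (suc n))

  ∑-+ : ∀ n (f g : ℕ → Carrier) → ∑≤ n (λ i → f i + g i) ≈ ∑≤ n f + ∑≤ n g
  ∑-+ zero    f g = ≈-refl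
  ∑-+ (suc n) f g = ≈-trans (+-congʳ (∑-+ n f g)) (interchange _ _ _ _)

  ∑-scale : ∀ n a (f : ℕ → Carrier) → ∑≤ n (λ i → a * f i) ≈ a * ∑≤ n f
  ∑-scale zero    a f = ≈-refl
  ∑-scale (suc n) a f = ≈-trans (+-congʳ (∑-scale n a f)) (≈-sym (distribˡ a _ _))

  ∑-zero : ∀ n (f : ℕ → Carrier) → (∀ i → f i ≈ 0#) → ∑≤ n f ≈ 0#
  ∑-zero zero    f f≈0 = f≈0 0
  ∑-zero (suc n) f f≈0 = ≈-trans (+-cong (∑-zero n f f≈0) (f≈0 (suc n))) (+-identityʳ 0#)

  ∑-shift : ∀ n (f : ℕ → Carrier) → ∑≤ (suc n) f ≈ f 0 + ∑≤ n (λ i → f (suc i))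
  ∑-shift zero    f = ≈-refl
  ∑-shift (suc n) f = ≈-trans (+-congʳ (∑-shift n f)) (+-assoc _ _ _)

  ∑-trunc : ∀ {n m} (f : ℕ → Carrier) → n ≤ m → (∀ i → n < i → f i ≈ 0#) → ∑≤ m f ≈ ∑≤ n f
  ∑-trunc {n} f n≤m tail≈0 = extend (NP.≤⇒≤′ n≤m)
    where
    extend : ∀ {m} → n ≤′ m → ∑≤ m f ≈ ∑≤ n f
    extend (ℕ.≤′-reflexive Eq.refl) = ≈-refl
    extend (ℕ.≤′-step n≤′m) =
      ≈-trans (+-cong (extend n≤′m) (tail≈0 _ (s≤s (NP.≤′⇒≤ n≤′m)))) (+-identityʳ _)

  -- Shift invariance of the matrices:  M_{i+1,j+1,k,ℓ} = q M_{i,j,k,ℓ}.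
  -- The guards of D and E depend only on j - i, so both branches scale by q.

  if-scaled : ∀ b {x y x′ y′} → x ≈ q * x′ → y ≈ q * y′ →
              (if b then x else y) ≈ q * (if b then x′ else y′)
  if-scaled true  x≈ _  = x≈
  if-scaled false _  y≈ = y≈

  zero-scaled : 0# ≈ q * 0#
  zero-scaled = ≈-sym (zeroʳ q)

  -- the recursive clauses of D and E are both of this shape
  recursion-scaled : ∀ e a b d → e * (q * a + q * b) + q * d ≈ q * (e * (a + b) + d)
  recursion-scaled e a b d =
    solve 5 (λ e a b d Q → e :* (Q :* a :+ Q :* b) :+ Q :* d := Q :* (e :* (a :+ b) :+ d)) ≈-refl e a b d q
    where open SemiringSolver

  mutual
    D-shift : ∀ k i j l → Dm (suc i) (suc j) k l ≈ q * Dm i j k l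
    D-shift k i j l = if-scaled ((j <ᵇ i) ∨ (suc k <ᵇ l)) zero-scaled (Dcore-shift k i j l)

    E-shift : ∀ k i j l → Em (suc i) (suc j) k l ≈ q * Em i j k l
    E-shift k i j l = if-scaled ((j <ᵇ i) ∨ (suc k <ᵇ l)) zero-scaled (Ecore-shift k i j l)

    Dcore-shift : ∀ k i j l → Dcore (suc i) (suc j) k l ≈ q * Dcore i j k l
    Dcore-shift zero i j l =
      if-scaled ((j ≡ᵇ suc i) ∧ (l ≡ᵇ 0)) (x∙yz≈y∙xz δ q _)
        (if-scaled ((j ≡ᵇ i) ∧ (l ≡ᵇ 1)) (x∙yz≈y∙xz α q _) zero-scaled)
    Dcore-shift (suc k) i j l =
      ≈-trans (+-cong (*-congˡ (+-cong (DjPrev-shift k i j l) (EjPrev-shift k i j l))) (DlPrev-shift k i j l))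
              (recursion-scaled δ _ _ _)

    Ecore-shift : ∀ k i j l → Ecore (suc i) (suc j) k l ≈ q * Ecore i j k l
    Ecore-shift zero i j l =
      if-scaled ((j ≡ᵇ i) ∧ (l ≡ᵇ 0)) (x∙yz≈y∙xz β q _)
        (if-scaled ((j ≡ᵇ i) ∧ (l ≡ᵇ 1)) (x∙yz≈y∙xz γ q _) zero-scaled)
    Ecore-shift (suc k) i j l =
      ≈-trans (+-cong (*-congˡ (+-cong (D-shift k i j l) (E-shift k i j l))) (*-congˡ (ElPrev-shift k i j l)))
              (recursion-scaled β _ _ _)

    DjPrev-shift : ∀ k i j l → DjPrev (suc i) (suc j) k l ≈ q * DjPrev i j k l
    DjPrev-shift k i zero    l = zero-scaled
    DjPrev-shift k i (suc j) l = D-shift k i j l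

    EjPrev-shift : ∀ k i j l → EjPrev (suc i) (suc j) k l ≈ q * EjPrev i j k l
    EjPrev-shift k i zero    l = zero-scaled
    EjPrev-shift k i (suc j) l = E-shift k i j l

    DlPrev-shift : ∀ k i j l → DlPrev (suc i) (suc j) k l ≈ q * DlPrev i j k l
    DlPrev-shift k i j zero    = zero-scaled
    DlPrev-shift k i j (suc l) = D-shift k i j l

    ElPrev-shift : ∀ k i j l → ElPrev (suc i) (suc j) k l ≈ q * ElPrev i j k l
    ElPrev-shift k i j zero    = zero-scaled
    ElPrev-shift k i j (suc l) = E-shift k i j l

  mat-shift : ∀ x i j k l → mat x (suc i) (suc j) k l ≈ q * mat x i j k l
  mat-shift 𝐃 i j k l = D-shift k i j l
  mat-shift 𝐄 i j k l = E-shift k i j l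

  -- Vanishing of the matrices:  M_{i,j,k,ℓ} = 0  when  j > i + k + 1  or  ℓ > k + 1.
  -- The first bound is inherited through the recursion in k from the base
  -- case k = 0, where only the columns j = i and j = i + 1 are nonzero.

  Far : ℕ → ℕ → ℕ → Set
  Far i j k = suc (k ℕ.+ i) < j

  far-weaken : ∀ {i j k} → Far i j (suc k) → Far i j k
  far-weaken far = NP.<-trans (NP.n<1+n _) far

  else-zero : ∀ b {x} → x ≈ 0# → (if b then 0# else x) ≈ 0#
  else-zero true  _   = ≈-refl
  else-zero false x≈0 = x≈0

  near-guard : ∀ {i j} m b {x y} → m ≤ suc i → suc (suc i) ≤ j → y ≈ 0# →
               (if (j ≡ᵇ m) ∧ b then x else y) ≈ 0#
  near-guard {i} {j} m b m≤ far y≈0 with j ≡ᵇ m in j≡ᵇm | b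
  ... | false | _     = y≈0
  ... | true  | false = y≈0
  ... | true  | true  = ⊥-elim (NP.<⇒≱ far (Eq.subst (_≤ suc i) (Eq.sym j≡m) m≤))
    where j≡m = NP.≡ᵇ⇒≡ j m (Eq.subst T (Eq.sym j≡ᵇm) _)

  plus-zero : ∀ {x y} → x ≈ 0# → y ≈ 0# → x + y ≈ 0#
  plus-zero x≈0 y≈0 = ≈-trans (+-cong x≈0 y≈0) (+-identityʳ 0#)

  times-zero : ∀ a {x} → x ≈ 0# → a * x ≈ 0#
  times-zero a x≈0 = ≈-trans (*-congˡ x≈0) (zeroʳ a)

  mutual
    D-far : ∀ k i j l → Far i j k → Dm i j k l ≈ 0#
    D-far k i j l far = else-zero ((j <ᵇ i) ∨ (suc k <ᵇ l)) (Dcore-far k i j l far)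

    E-far : ∀ k i j l → Far i j k → Em i j k l ≈ 0#
    E-far k i j l far = else-zero ((j <ᵇ i) ∨ (suc k <ᵇ l)) (Ecore-far k i j l far)

    Dcore-far : ∀ k i j l → Far i j k → Dcore i j k l ≈ 0#
    Dcore-far zero i j l far =
      near-guard (suc i) (l ≡ᵇ 0) NP.≤-refl far (near-guard i (l ≡ᵇ 1) (NP.n≤1+n i) far ≈-refl)
    Dcore-far (suc k) i j l far =
      plus-zero (times-zero δ (plus-zero (DjPrev-far k i j l far) (EjPrev-far k i j l far))) (DlPrev-far k i j l far)

    Ecore-far : ∀ k i j l → Far i j k → Ecore i j k l ≈ 0#
    Ecore-far zero i j l far =
      near-guard i (l ≡ᵇ 0) (NP.n≤1+n i) far (near-guard i (l ≡ᵇ 1) (NP.n≤1+n i) far ≈-refl)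
    Ecore-far (suc k) i j l far =
      plus-zero (times-zero β (plus-zero (D-far k i j l far′) (E-far k i j l far′)))
                (times-zero q (ElPrev-far k i j l far))
      where far′ = far-weaken {i} {j} {k} far

    DjPrev-far : ∀ k i j l → Far i j (suc k) → DjPrev i j k l ≈ 0#
    DjPrev-far k i zero    l _          = ≈-refl
    DjPrev-far k i (suc j) l (s≤s far) = D-far k i j l far

    EjPrev-far : ∀ k i j l → Far i j (suc k) → EjPrev i j k l ≈ 0#
    EjPrev-far k i zero    l _          = ≈-refl
    EjPrev-far k i (suc j) l (s≤s far) = E-far k i j l far

    DlPrev-far : ∀ k i j l → Far i j (suc k) → DlPrev i j k l ≈ 0#
    DlPrev-far k i j zero    _   = ≈-refl
    DlPrev-far k i j (suc l) far = D-far k i j l (far-weaken {i} {j} {k} far)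

    ElPrev-far : ∀ k i j l → Far i j (suc k) → ElPrev i j k l ≈ 0#
    ElPrev-far k i j zero    _   = ≈-refl
    ElPrev-far k i j (suc l) far = E-far k i j l (far-weaken {i} {j} {k} far)

  shape-guard : ∀ b b′ {x} → T b′ → (if b ∨ b′ then 0# else x) ≈ 0#
  shape-guard true  _    _ = ≈-refl
  shape-guard false true _ = ≈-refl

  mat-vanish : ∀ x i j k l → Far i j k ⊎ suc k < l → mat x i j k l ≈ 0#
  mat-vanish 𝐃 i j k l (inj₁ far) = D-far k i j l far
  mat-vanish 𝐄 i j k l (inj₁ far) = E-far k i j l far
  mat-vanish 𝐃 i j k l (inj₂ k+1<l) = shape-guard (j <ᵇ i) (suc k <ᵇ l) (NP.<⇒<ᵇ k+1<l)
  mat-vanish 𝐄 i j k l (inj₂ k+1<l) = shape-guard (j <ᵇ i) (suc k <ᵇ l) (NP.<⇒<ᵇ k+1<l)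

  infix 4 _≋_
  _≋_ : Row → Row → Set ℓ'
  v ≋ w = ∀ j l → v j l ≈ w j l

  rowSetoid : Setoid c ℓ'
  rowSetoid = record
    { Carrier       = Row
    ; _≈_           = _≋_
    ; isEquivalence = record
      { refl  = λ j l → ≈-refl
      ; sym   = λ v≋w j l → ≈-sym (v≋w j l)
      ; trans = λ u≋v v≋w j l → ≈-trans (u≋v j l) (v≋w j l)
      }
    }
  module ≋-Reasoning = SetoidReasoning rowSetoid
  open Setoid rowSetoid using () renaming (refl to ≋-refl; sym to ≋-sym; trans to ≋-trans)

  ≡⇒≋ : ∀ {v w} → v ≡ w → v ≋ w
  ≡⇒≋ Eq.refl = ≋-refl

  infixl 6 _⊕_
  infixr 7 _·_
  _⊕_ : Row → Row → Row
  (v ⊕ w) j l = v j l + w j l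

  _·_ : Carrier → Row → Row
  (a · v) j l = a * v j l

  ⊕-cong : ∀ {v v′ w w′} → v ≋ v′ → w ≋ w′ → v ⊕ w ≋ v′ ⊕ w′
  ⊕-cong v≋ w≋ j l = +-cong (v≋ j l) (w≋ j l)

  ·-cong : ∀ a {v w} → v ≋ w → a · v ≋ a · w
  ·-cong a v≋w j l = *-congˡ (v≋w j l)

  ·-assoc : ∀ a b v → a · (b · v) ≋ (a * b) · v
  ·-assoc a b v j l = ≈-sym (*-assoc a b (v j l))

  shiftʲ : Row → Row
  shiftʲ v zero    l = 0#
  shiftʲ v (suc j) l = v j l

  shiftˡ : Row → Row
  shiftˡ v j zero    = 0#
  shiftˡ v j (suc l) = v j l

  shiftʲ-cong : ∀ {v w} → v ≋ w → shiftʲ v ≋ shiftʲ w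
  shiftʲ-cong v≋w zero    l = ≈-refl
  shiftʲ-cong v≋w (suc j) l = v≋w j l

  WXprev≋ : ∀ X → WXprev X ≋ shiftʲ (WX X)
  WXprev≋ X zero    l = ≈-refl
  WXprev≋ X (suc j) l = ≈-refl

  WXprevℓ≋ : ∀ X → WXprevℓ X ≋ shiftˡ (WX X)
  WXprevℓ≋ X j zero    = ≈-refl
  WXprevℓ≋ X j (suc l) = ≈-refl

  WXprev2≋ : ∀ X → WXprev2 X ≋ shiftʲ (shiftˡ (WX X))
  WXprev2≋ X zero    l       = ≈-refl
  WXprev2≋ X (suc j) zero    = ≈-refl
  WXprev2≋ X (suc j) (suc l) = ≈-refl

  Supp : ℕ → ℕ → Row → Set ℓ'
  Supp A B v = ∀ a b → A < a ⊎ B < b → v a b ≈ 0#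

  supp-mono : ∀ {A B A′ B′ v} → Supp A B v → A ≤ A′ → B ≤ B′ → Supp A′ B′ v
  supp-mono supp A≤ B≤ a b (inj₁ A′<a) = supp a b (inj₁ (NP.≤-<-trans A≤ A′<a))
  supp-mono supp A≤ B≤ a b (inj₂ B′<b) = supp a b (inj₂ (NP.≤-<-trans B≤ B′<b))

  supp-⊕ : ∀ {A B v w} → Supp A B v → Supp A B w → Supp A B (v ⊕ w)
  supp-⊕ supp-v supp-w a b out = plus-zero (supp-v a b out) (supp-w a b out)

  supp-shiftˡ : ∀ {A B v} → Supp A B v → Supp A (suc B) (shiftˡ v)
  supp-shiftˡ supp a zero    _                 = ≈-refl
  supp-shiftˡ supp a (suc b) (inj₁ A<a)        = supp a b (inj₁ A<a)
  supp-shiftˡ supp a (suc b) (inj₂ (s≤s B<b)) = supp a b (inj₂ B<b)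

  step-cong : ∀ n {v w} M → v ≋ w → step n v M ≋ step n w M
  step-cong n M v≋w j l = ∑-cong j (λ a → ∑-cong n (λ b → *-congʳ (v≋w a b)))

  step-⊕ : ∀ n v w M → step n (v ⊕ w) M ≋ step n v M ⊕ step n w M
  step-⊕ n v w M j l =
    ≈-trans (∑-cong j (λ a → ≈-trans (∑-cong n (λ b → distribʳ _ _ _)) (∑-+ n _ _))) (∑-+ j _ _)

  step-· : ∀ n a v M → step n (a · v) M ≋ a · step n v M
  step-· n a v M j l =
    ≈-trans (∑-cong j (λ i → ≈-trans (∑-cong n (λ b → *-assoc _ _ _)) (∑-scale n a _))) (∑-scale j a _)

  -- by shift invariance of the matrices, (shiftʲ v) M = q · shiftʲ (v M)
  step-shift : ∀ n v x → step n (shiftʲ v) (mat x) ≋ q · shiftʲ (step n v (mat x))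
  step-shift n v x zero    l = ≈-trans (∑-zero n _ (λ b → zeroˡ _)) zero-scaled
  step-shift n v x (suc j) l = begin
      ∑≤ (suc j) (λ a → ∑≤ n (λ b → shiftʲ v a b * mat x a (suc j) b l))
    ≈⟨ ∑-shift j _ ⟩
      ∑≤ n (λ b → 0# * mat x 0 (suc j) b l)
        + ∑≤ j (λ a → ∑≤ n (λ b → v a b * mat x (suc a) (suc j) b l))
    ≈⟨ +-cong (∑-zero n _ (λ b → zeroˡ _))
              (∑-cong j (λ a → ∑-cong n (λ b → *-congˡ (mat-shift x a j b l)))) ⟩
      0# + ∑≤ j (λ a → ∑≤ n (λ b → v a b * (q * mat x a j b l)))
    ≈⟨ +-identityˡ _ ⟩
      ∑≤ j (λ a → ∑≤ n (λ b → v a b * (q * mat x a j b l)))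
    ≈⟨ ∑-cong j (λ a → ≈-trans (∑-cong n (λ b → x∙yz≈y∙xz _ q _)) (∑-scale n q _)) ⟩
      ∑≤ j (λ a → q * ∑≤ n (λ b → v a b * mat x a j b l))
    ≈⟨ ∑-scale j q _ ⟩
      q * step n v (mat x) j l
    ∎
    where open ≈-Reasoning

  step-stable : ∀ {n m A v} M → n ≤ m → Supp A n v → step m v M ≋ step n v M
  step-stable M n≤m supp j l =
    ∑-cong j (λ a → ∑-trunc _ n≤m (λ b n<b → ≈-trans (*-congʳ (supp a b (inj₂ n<b))) (zeroˡ _)))

  step-support : ∀ {A n v} x → Supp A n v → Supp (suc (n ℕ.+ A)) (suc n) (step n v (mat x))
  step-support {A} {n} {v} x supp j l out = ∑-zero j _ (λ a → ∑-zero n _ (λ b → term a b))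
    where
    entry-vanish : ∀ {a b} → a ≤ A → b ≤ n → mat x a j b l ≈ 0#
    entry-vanish {a} {b} a≤A b≤n = mat-vanish x a j b l (entry-out out)
      where
      entry-out : suc (n ℕ.+ A) < j ⊎ suc n < l → Far a j b ⊎ suc b < l
      entry-out (inj₁ far)    = inj₁ (NP.≤-<-trans (s≤s (NP.+-mono-≤ b≤n a≤A)) far)
      entry-out (inj₂ n+1<l) = inj₂ (NP.≤-<-trans (s≤s b≤n) n+1<l)
    term : ∀ a b → v a b * mat x a j b l ≈ 0#
    term a b with A <? a | n <? b
    ... | yes A<a | _       = ≈-trans (*-congʳ (supp a b (inj₁ A<a))) (zeroˡ _)
    ... | no _    | yes n<b = ≈-trans (*-congʳ (supp a b (inj₂ n<b))) (zeroˡ _)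
    ... | no A≮a  | no n≮b  = times-zero (v a b) (entry-vanish (NP.≮⇒≥ A≮a) (NP.≮⇒≥ n≮b))

  go-cong : ∀ Y n {v w} → v ≋ w → go n v Y ≋ go n w Y
  go-cong []      n v≋w = v≋w
  go-cong (x ∷ Y) n v≋w = go-cong Y (suc n) (step-cong n (mat x) v≋w)

  go-⊕ : ∀ Y n v w → go n (v ⊕ w) Y ≋ go n v Y ⊕ go n w Y
  go-⊕ []      n v w = ≋-refl
  go-⊕ (x ∷ Y) n v w = ≋-trans (go-cong Y (suc n) (step-⊕ n v w (mat x))) (go-⊕ Y (suc n) _ _)

  go-· : ∀ Y n a v → go n (a · v) Y ≋ a · go n v Y
  go-· []      n a v = ≋-refl
  go-· (x ∷ Y) n a v = ≋-trans (go-cong Y (suc n) (step-· n a v (mat x))) (go-· Y (suc n) a _)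

  go-shift : ∀ Y n v → go n (shiftʲ v) Y ≋ pow q (length Y) · shiftʲ (go n v Y)
  go-shift []      n v zero    l = ≈-sym (zeroʳ 1#)
  go-shift []      n v (suc j) l = ≈-sym (*-identityˡ _)
  go-shift (x ∷ Y) n v = begin
      go (suc n) (step n (shiftʲ v) (mat x)) Y
    ≈⟨ go-cong Y (suc n) (step-shift n v x) ⟩
      go (suc n) (q · shiftʲ (step n v (mat x))) Y
    ≈⟨ go-· Y (suc n) q _ ⟩
      q · go (suc n) (shiftʲ (step n v (mat x))) Y
    ≈⟨ ·-cong q (go-shift Y (suc n) _) ⟩
      q · (pow q (length Y) · shiftʲ (go (suc n) (step n v (mat x)) Y))
    ≈⟨ ·-assoc q _ _ ⟩
      pow q (suc (length Y)) · shiftʲ (go (suc n) (step n v (mat x)) Y)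
    ∎
    where open ≋-Reasoning

  go-combination : ∀ Y n a b e v w →
    go n ((a · v ⊕ b · w) ⊕ e · shiftʲ w) Y
      ≋ (a · go n v Y ⊕ b · go n w Y) ⊕ e · (pow q (length Y) · shiftʲ (go n w Y))
  go-combination Y n a b e v w =
    ≋-trans (go-⊕ Y n _ _)
      (⊕-cong (≋-trans (go-⊕ Y n _ _) (⊕-cong (go-· Y n a v) (go-· Y n b w)))
              (≋-trans (go-· Y n e _) (·-cong e (go-shift Y n w))))

  go-stable : ∀ Y {n m A v} → n ≤ m → Supp A n v → go m v Y ≋ go n v Y
  go-stable []      n≤m supp = ≋-refl
  go-stable (x ∷ Y) n≤m supp =
    ≋-trans (go-cong Y _ (step-stable (mat x) n≤m supp)) (go-stable Y (s≤s n≤m) (step-support x supp))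

  go-support : ∀ Y n v → Supp (n ℕ.* n) n v →
               Supp ((length Y ℕ.+ n) ℕ.* (length Y ℕ.+ n)) (length Y ℕ.+ n) (go n v Y)
  go-support []      n v supp = supp
  go-support (x ∷ Y) n v supp =
    Eq.subst (λ k → Supp (k ℕ.* k) k (go (suc n) (step n v (mat x)) Y)) (NP.+-suc (length Y) n)
      (go-support Y (suc n) _ (supp-mono (step-support x supp) square-step NP.≤-refl))
    where
    square-step : suc (n ℕ.+ n ℕ.* n) ≤ suc n ℕ.* suc n
    square-step = s≤s (NP.+-monoʳ-≤ n (NP.*-monoʳ-≤ n (NP.n≤1+n n)))

  W-support : Supp 0 0 Wrow
  W-support zero    zero    (inj₁ ())
  W-support zero    zero    (inj₂ ())
  W-support zero    (suc b) _ = ≈-refl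
  W-support (suc a) b       _ = ≈-refl

  WX-support : ∀ {L} Z → length Z ≤ L → Supp (L ℕ.* L) L (WX Z)
  WX-support Z |Z|≤L =
    supp-mono (Eq.subst (λ k → Supp (k ℕ.* k) k (WX Z)) (NP.+-identityʳ (length Z)) (go-support Z 0 Wrow W-support))
              (NP.*-mono-≤ |Z|≤L |Z|≤L) |Z|≤L

  go-++ : ∀ X Y n v → go n v (X ++ Y) ≡ go (length X ℕ.+ n) (go n v X) Y
  go-++ []      Y n v = Eq.refl
  go-++ (x ∷ X) Y n v =
    Eq.trans (go-++ X Y (suc n) _) (Eq.cong (λ k → go k (go (suc n) (step n v (mat x)) X) Y) (NP.+-suc (length X) n))

  WX-split : ∀ X P Y → WX (X ++ P ++ Y) ≡ go (length X ℕ.+ length P) (WX (X ++ P)) Y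
  WX-split X P Y = begin
      WX (X ++ P ++ Y)
    ≡⟨ Eq.cong WX (Eq.sym (++-assoc X P Y)) ⟩
      WX ((X ++ P) ++ Y)
    ≡⟨ go-++ (X ++ P) Y 0 Wrow ⟩
      go (length (X ++ P) ℕ.+ 0) (WX (X ++ P)) Y
    ≡⟨ Eq.cong (λ k → go k (WX (X ++ P)) Y) (Eq.trans (NP.+-identityʳ _) (length-++ X)) ⟩
      go (length X ℕ.+ length P) (WX (X ++ P)) Y
    ∎
    where open Eq.≡-Reasoning

  Tot : ℕ → Row → Carrier
  Tot N v = ∑≤ N (λ j → ∑≤ N (λ l → v j l))

  Tot-cong : ∀ N {v w} → v ≋ w → Tot N v ≈ Tot N w
  Tot-cong N v≋w = ∑-cong N (λ j → ∑-cong N (λ l → v≋w j l))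

  Tot-· : ∀ N a v → Tot N (a · v) ≈ a * Tot N v
  Tot-· N a v = ≈-trans (∑-cong N (λ j → ∑-scale N a _)) (∑-scale N a _)

  Tot-⊕ : ∀ N v w → Tot N (v ⊕ w) ≈ Tot N v + Tot N w
  Tot-⊕ N v w = ≈-trans (∑-cong N (λ j → ∑-+ N _ _)) (∑-+ N _ _)

  Tot-combination : ∀ N a b e u v w →
    Tot N ((a · u ⊕ b · v) ⊕ e · w) ≈ (a * Tot N u + b * Tot N v) + e * Tot N w
  Tot-combination N a b e u v w =
    ≈-trans (Tot-⊕ N _ _) (+-cong (≈-trans (Tot-⊕ N _ _) (+-cong (Tot-· N a u) (Tot-· N b v))) (Tot-· N e w))

  ∑∑-support : ∀ {A B N M v} → Supp A B v → A ≤ N → B ≤ M →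
               ∑≤ N (λ j → ∑≤ M (λ l → v j l)) ≈ ∑≤ A (λ j → ∑≤ B (λ l → v j l))
  ∑∑-support {A} {B} {N} {M} {v} supp A≤N B≤M =
    ≈-trans (∑-cong N (λ j → ∑-trunc _ B≤M (λ b B<b → supp j b (inj₂ B<b))))
            (∑-trunc _ A≤N (λ a A<a → ∑-zero B _ (λ b → supp a b (inj₁ A<a))))

  Tot-shiftʲ : ∀ {A B N v} → Supp A B v → A ≤ N → B ≤ N → Tot (suc N) (shiftʲ v) ≈ Tot (suc N) v
  Tot-shiftʲ {A} {B} {N} {v} supp A≤N B≤N = begin
      Tot (suc N) (shiftʲ v)
    ≈⟨ ∑-shift N _ ⟩
      ∑≤ (suc N) (λ l → 0#) + ∑≤ N (λ j → ∑≤ (suc N) (λ l → v j l))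
    ≈⟨ +-cong (∑-zero (suc N) _ (λ _ → ≈-refl)) (∑∑-support supp A≤N (NP.m≤n⇒m≤1+n B≤N)) ⟩
      0# + ∑≤ A (λ j → ∑≤ B (λ l → v j l))
    ≈⟨ +-identityˡ _ ⟩
      ∑≤ A (λ j → ∑≤ B (λ l → v j l))
    ≈⟨ ∑∑-support supp (NP.m≤n⇒m≤1+n A≤N) (NP.m≤n⇒m≤1+n B≤N) ⟨
      Tot (suc N) v
    ∎
    where open ≈-Reasoning

  Tot-shiftˡ : ∀ {A B N v} → Supp A B v → A ≤ N → B ≤ N → Tot (suc N) (shiftˡ v) ≈ Tot (suc N) v
  Tot-shiftˡ {A} {B} {N} {v} supp A≤N B≤N = begin
      Tot (suc N) (shiftˡ v)
    ≈⟨ ∑-cong (suc N) (λ j → ≈-trans (∑-shift N _) (+-identityˡ _)) ⟩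
      ∑≤ (suc N) (λ j → ∑≤ N (λ l → v j l))
    ≈⟨ ∑∑-support supp (NP.m≤n⇒m≤1+n A≤N) B≤N ⟩
      ∑≤ A (λ j → ∑≤ B (λ l → v j l))
    ≈⟨ ∑∑-support supp (NP.m≤n⇒m≤1+n A≤N) (NP.m≤n⇒m≤1+n B≤N) ⟨
      Tot (suc N) v
    ∎
    where open ≈-Reasoning

  -- the window [0, L² + L]² contains the supports of all rows W Z with |Z| ≤ L and of their shifts
  window : ℕ → ℕ
  window L = L ℕ.* L ℕ.+ L

  square≤window : ∀ {A} L → A ≤ L ℕ.* L → A ≤ window L
  square≤window L A≤ = NP.≤-trans A≤ (NP.m≤m+n _ L)

  side≤window : ∀ {B} L → B ≤ L → B ≤ window L
  side≤window L B≤ = NP.≤-trans B≤ (NP.m≤n+m L _)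

  Tot-window-shiftʲ : ∀ {L v} → Supp (L ℕ.* L) L v →
                      Tot (suc (window L)) (shiftʲ v) ≈ Tot (suc (window L)) v
  Tot-window-shiftʲ {L} supp = Tot-shiftʲ supp (square≤window L NP.≤-refl) (side≤window L NP.≤-refl)

  Tot-window-shiftˡ : ∀ {L v} → Supp (L ℕ.* L) L v →
                      Tot (suc (window L)) (shiftˡ v) ≈ Tot (suc (window L)) v
  Tot-window-shiftˡ {L} supp = Tot-shiftˡ supp (square≤window L NP.≤-refl) (side≤window L NP.≤-refl)

  WXV-window : ∀ L Z → length Z ≤ L → WXV Z ≈ Tot (suc (window L)) (WX Z)
  WXV-window L Z |Z|≤L =
    ≈-trans (∑∑-support supp (NP.*-mono-≤ (NP.n≤1+n z) (NP.n≤1+n z)) (NP.m≤n⇒m≤1+n (NP.m≤m+n z _)))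
      (≈-sym (∑∑-support supp (NP.m≤n⇒m≤1+n (square≤window L (NP.*-mono-≤ |Z|≤L |Z|≤L)))
                              (NP.m≤n⇒m≤1+n (side≤window L |Z|≤L))))
    where
    z = length Z
    supp : Supp (z ℕ.* z) z (WX Z)
    supp = WX-support Z NP.≤-refl

  pow-+ : ∀ a b → pow q (a ℕ.+ b) ≈ pow q a * pow q b
  pow-+ zero    b = ≈-sym (*-identityˡ _)
  pow-+ (suc a) b = ≈-trans (*-congˡ (pow-+ a b)) (≈-sym (*-assoc _ _ _))

  collect : ∀ {x} e a k t → x ≈ (e + a * t) + (- k) * t → x ⊖ e ≈ (a ⊖ k) * t
  collect {x} e a k t x≈ = begin
      x + - e
    ≈⟨ +-congʳ (≈-trans x≈ (+-assoc _ _ _)) ⟩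
      (e + (a * t + (- k) * t)) + - e
    ≈⟨ solve 3 (λ e y f → (e :+ y) :+ f := (e :+ f) :+ y) ≈-refl e _ (- e) ⟩
      (e + - e) + (a * t + (- k) * t)
    ≈⟨ ≈-trans (+-congʳ (-‿inverseʳ e)) (+-identityˡ _) ⟩
      a * t + (- k) * t
    ≈⟨ distribʳ t a (- k) ⟨
      (a ⊖ k) * t
    ∎
    where
    open ≈-Reasoning
    open SemiringSolver using (solve; _:+_; _:=_)

  sub-as-combination : ∀ x k y → x ⊖ k * y ≈ x + (- k) * y
  sub-as-combination x k y = +-congˡ (-‿distribˡ-* k y)

  HypothesisB : Set ℓ'
  HypothesisB = (X : List Letter) (j l : ℕ) →
    β * WX (X ++ 𝐃 ∷ []) j l
      ≈ (δ * WXprev (X ++ 𝐄 ∷ []) j l + α * β * WXprevℓ X j l)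
        ⊖ γ * δ * pow q (length X) * WXprev2 X j l

  relationB-row : HypothesisB → ∀ X →
    β · WX (X ++ 𝐃 ∷ [])
      ≋ (δ · shiftʲ (WX (X ++ 𝐄 ∷ [])) ⊕ (α * β) · shiftˡ (WX X))
        ⊕ (- (γ * δ * pow q (length X))) · shiftʲ (shiftˡ (WX X))
  relationB-row hyp X j l =
    ≈-trans (hyp X j l)
      (≈-trans (sub-as-combination _ _ _)
        (+-cong (+-cong (*-congˡ (WXprev≋ _ j l)) (*-congˡ (WXprevℓ≋ X j l))) (*-congˡ (WXprev2≋ X j l))))

  partB : HypothesisB → (X : List Letter) →
          β * WXV (X ++ 𝐃 ∷ []) ⊖ δ * WXV (X ++ 𝐄 ∷ []) ≈ lam (length X +ᴺ 1) * WXV X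
  partB hyp X = begin
      β * WXV XD ⊖ δ * WXV XE
    ≈⟨ +-cong (*-congˡ (WXV-window L XD |X₁|≤L)) (-‿cong (*-congˡ (WXV-window L XE |X₁|≤L))) ⟩
      β * Tot K (WX XD) ⊖ δ * Tot K (WX XE)
    ≈⟨ collect _ _ _ _ totals ⟩
      (α * β ⊖ k) * Tot K (WX X)
    ≈⟨ *-cong lam-exponent (≈-sym (WXV-window L X n≤L)) ⟩
      lam L * WXV X
    ∎
    where
    open ≈-Reasoning
    n = length X
    L = n ℕ.+ 1
    K = suc (window L)
    k = γ * δ * pow q n
    XD = X ++ 𝐃 ∷ []
    XE = X ++ 𝐄 ∷ []
    n≤L : n ≤ L
    n≤L = NP.m≤m+n n 1
    |X₁|≤L : ∀ {a} → length (X ++ a ∷ []) ≤ L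
    |X₁|≤L = NP.≤-reflexive (length-++ X)
    lam-exponent : α * β ⊖ k ≈ lam L
    lam-exponent = Eq.subst (λ t → α * β ⊖ k ≈ α * β ⊖ γ * δ * pow q t) (Eq.sym (NP.m+n∸n≡m n 1)) ≈-refl
    supp-X : Supp (L ℕ.* L) L (WX X)
    supp-X = WX-support X n≤L
    supp-shiftˡX : Supp (L ℕ.* L) L (shiftˡ (WX X))
    supp-shiftˡX =
      supp-mono (supp-shiftˡ (WX-support X NP.≤-refl)) (NP.*-mono-≤ n≤L n≤L) (NP.≤-reflexive (NP.+-comm 1 n))
    totals : β * Tot K (WX XD) ≈ (δ * Tot K (WX XE) + α * β * Tot K (WX X)) + (- k) * Tot K (WX X)
    totals = begin
        β * Tot K (WX XD)
      ≈⟨ Tot-· K β _ ⟨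
        Tot K (β · WX XD)
      ≈⟨ Tot-cong K (relationB-row hyp X) ⟩
        Tot K ((δ · shiftʲ (WX XE) ⊕ (α * β) · shiftˡ (WX X)) ⊕ (- k) · shiftʲ (shiftˡ (WX X)))
      ≈⟨ Tot-combination K _ _ _ _ _ _ ⟩
        (δ * Tot K (shiftʲ (WX XE)) + α * β * Tot K (shiftˡ (WX X))) + (- k) * Tot K (shiftʲ (shiftˡ (WX X)))
      ≈⟨ +-cong (+-cong (*-congˡ (Tot-window-shiftʲ (WX-support XE |X₁|≤L)))
                        (*-congˡ (Tot-window-shiftˡ supp-X)))
                (*-congˡ (≈-trans (Tot-window-shiftʲ supp-shiftˡX) (Tot-window-shiftˡ supp-X))) ⟩
        (δ * Tot K (WX XE) + α * β * Tot K (WX X)) + (- k) * Tot K (WX X)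
      ∎

  HypothesisA : Set ℓ'
  HypothesisA = (X : List Letter) (j l : ℕ) →
    WX (X ++ 𝐃 ∷ 𝐄 ∷ []) j l
      ≈ (q * WX (X ++ 𝐄 ∷ 𝐃 ∷ []) j l
         + α * β * (WX (X ++ 𝐃 ∷ []) j l + WX (X ++ 𝐄 ∷ []) j l))
        ⊖ γ * δ * pow q (length X +ᴺ 1)
            * (WXprev (X ++ 𝐃 ∷ []) j l + WXprev (X ++ 𝐄 ∷ []) j l)

  relationA-row : HypothesisA → ∀ X Y →
    let U = WX (X ++ 𝐃 ∷ Y) ⊕ WX (X ++ 𝐄 ∷ Y) in
    WX (X ++ 𝐃 ∷ 𝐄 ∷ Y)
      ≋ (q · WX (X ++ 𝐄 ∷ 𝐃 ∷ Y) ⊕ (α * β) · U)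
        ⊕ (- (γ * δ * pow q (length X ℕ.+ 1))) · (pow q (length Y) · shiftʲ U)
  relationA-row hyp X Y = begin
      WX (X ++ 𝐃 ∷ 𝐄 ∷ Y)
    ≡⟨ WX-split X (𝐃 ∷ 𝐄 ∷ []) Y ⟩
      go (n ℕ.+ 2) (WX (X ++ 𝐃 ∷ 𝐄 ∷ [])) Y
    ≈⟨ go-cong Y _ at-X ⟩
      go (n ℕ.+ 2) ((q · WX (X ++ 𝐄 ∷ 𝐃 ∷ []) ⊕ (α * β) · U₁) ⊕ e · shiftʲ U₁) Y
    ≈⟨ go-combination Y _ _ _ _ _ _ ⟩
      (q · go (n ℕ.+ 2) (WX (X ++ 𝐄 ∷ 𝐃 ∷ [])) Y ⊕ (α * β) · go (n ℕ.+ 2) U₁ Y)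
        ⊕ e · (pow q (length Y) · shiftʲ (go (n ℕ.+ 2) U₁ Y))
    ≈⟨ ⊕-cong (⊕-cong (·-cong q (≡⇒≋ (Eq.sym (WX-split X (𝐄 ∷ 𝐃 ∷ []) Y)))) (·-cong _ suffix-U))
              (·-cong e (·-cong _ (shiftʲ-cong suffix-U))) ⟩
      (q · WX (X ++ 𝐄 ∷ 𝐃 ∷ Y) ⊕ (α * β) · U) ⊕ e · (pow q (length Y) · shiftʲ U)
    ∎
    where
    open ≋-Reasoning
    n = length X
    e = - (γ * δ * pow q (n ℕ.+ 1))
    U = WX (X ++ 𝐃 ∷ Y) ⊕ WX (X ++ 𝐄 ∷ Y)
    U₁ = WX (X ++ 𝐃 ∷ []) ⊕ WX (X ++ 𝐄 ∷ [])
    at-X : WX (X ++ 𝐃 ∷ 𝐄 ∷ []) ≋ (q · WX (X ++ 𝐄 ∷ 𝐃 ∷ []) ⊕ (α * β) · U₁) ⊕ e · shiftʲ U₁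
    at-X j l = ≈-trans (hyp X j l) (≈-trans (sub-as-combination _ _ _) (+-congˡ (*-congˡ (prev-sum j l))))
      where
      prev-sum : ∀ j l → WXprev (X ++ 𝐃 ∷ []) j l + WXprev (X ++ 𝐄 ∷ []) j l ≈ shiftʲ U₁ j l
      prev-sum zero    l = +-identityʳ 0#
      prev-sum (suc j) l = ≈-refl
    |X₁|≤ : ∀ a → length (X ++ a ∷ []) ≤ n ℕ.+ 1
    |X₁|≤ a = NP.≤-reflexive (length-++ X)
    supp-U₁ : Supp ((n ℕ.+ 1) ℕ.* (n ℕ.+ 1)) (n ℕ.+ 1) U₁
    supp-U₁ = supp-⊕ (WX-support (X ++ 𝐃 ∷ []) (|X₁|≤ 𝐃)) (WX-support (X ++ 𝐄 ∷ []) (|X₁|≤ 𝐄))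
    suffix-U : go (n ℕ.+ 2) U₁ Y ≋ U
    suffix-U = begin
        go (n ℕ.+ 2) U₁ Y
      ≈⟨ go-stable Y (NP.+-monoʳ-≤ n (NP.n≤1+n 1)) supp-U₁ ⟩
        go (n ℕ.+ 1) U₁ Y
      ≈⟨ go-⊕ Y _ _ _ ⟩
        go (n ℕ.+ 1) (WX (X ++ 𝐃 ∷ [])) Y ⊕ go (n ℕ.+ 1) (WX (X ++ 𝐄 ∷ [])) Y
      ≡⟨ Eq.sym (Eq.cong₂ _⊕_ (WX-split X (𝐃 ∷ []) Y) (WX-split X (𝐄 ∷ []) Y)) ⟩
        U
      ∎

  partA : HypothesisA → (X Y : List Letter) →
          WXV (X ++ 𝐃 ∷ 𝐄 ∷ Y) ⊖ q * WXV (X ++ 𝐄 ∷ 𝐃 ∷ Y)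
            ≈ lam (length X +ᴺ length Y +ᴺ 2) * (WXV (X ++ 𝐃 ∷ Y) + WXV (X ++ 𝐄 ∷ Y))
  partA hyp X Y = begin
      WXV (X ++ 𝐃 ∷ 𝐄 ∷ Y) ⊖ q * WXV (X ++ 𝐄 ∷ 𝐃 ∷ Y)
    ≈⟨ +-cong (WXV-window L (X ++ 𝐃 ∷ 𝐄 ∷ Y) |X₂Y|≤L)
              (-‿cong (*-congˡ (WXV-window L (X ++ 𝐄 ∷ 𝐃 ∷ Y) |X₂Y|≤L))) ⟩
      Tot K (WX (X ++ 𝐃 ∷ 𝐄 ∷ Y)) ⊖ q * Tot K (WX (X ++ 𝐄 ∷ 𝐃 ∷ Y))
    ≈⟨ collect _ _ _ _ totals ⟩
      (α * β ⊖ k * pow q m) * Tot K U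
    ≈⟨ *-cong lam-exponent (Tot-⊕ K _ _) ⟩
      lam L * (Tot K (WX (X ++ 𝐃 ∷ Y)) + Tot K (WX (X ++ 𝐄 ∷ Y)))
    ≈⟨ *-congˡ (+-cong (WXV-window L (X ++ 𝐃 ∷ Y) |X₁Y|≤L) (WXV-window L (X ++ 𝐄 ∷ Y) |X₁Y|≤L)) ⟨
      lam L * (WXV (X ++ 𝐃 ∷ Y) + WXV (X ++ 𝐄 ∷ Y))
    ∎
    where
    open ≈-Reasoning
    open +-*-Solver using (_:=_; _:+_; con) renaming (solve to solveℕ)
    n = length X
    m = length Y
    L = n ℕ.+ m ℕ.+ 2
    K = suc (window L)
    k = γ * δ * pow q (n ℕ.+ 1)
    U = WX (X ++ 𝐃 ∷ Y) ⊕ WX (X ++ 𝐄 ∷ Y)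
    |X₂Y|≤L : ∀ {a b} → length (X ++ a ∷ b ∷ Y) ≤ L
    |X₂Y|≤L = NP.≤-reflexive (Eq.trans (length-++ X)
                (solveℕ 2 (λ n m → n :+ (con 2 :+ m) := n :+ m :+ con 2) Eq.refl n m))
    |X₁Y|≤L : ∀ {a} → length (X ++ a ∷ Y) ≤ L
    |X₁Y|≤L = NP.≤-trans (NP.≤-reflexive (Eq.trans (length-++ X)
                  (solveℕ 2 (λ n m → n :+ (con 1 :+ m) := n :+ m :+ con 1) Eq.refl n m)))
                (NP.+-monoʳ-≤ (n ℕ.+ m) (NP.n≤1+n 1))
    -- q^{n+1} q^m = q^{L-1}
    lam-exponent : α * β ⊖ k * pow q m ≈ lam L
    lam-exponent =
      +-congˡ (-‿cong (≈-trans (*-assoc _ _ _) (*-congˡ (≈-sym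
        (Eq.subst (λ t → pow q t ≈ pow q (n ℕ.+ 1) * pow q m) exponent (pow-+ (n ℕ.+ 1) m))))))
      where
      exponent : n ℕ.+ 1 ℕ.+ m ≡ L ∸ 1
      exponent = Eq.trans (solveℕ 2 (λ n m → n :+ con 1 :+ m := n :+ m :+ con 1) Eq.refl n m)
                          (Eq.sym (NP.+-∸-assoc (n ℕ.+ m) (s≤s ℕ.z≤n)))
    totals : Tot K (WX (X ++ 𝐃 ∷ 𝐄 ∷ Y))
               ≈ (q * Tot K (WX (X ++ 𝐄 ∷ 𝐃 ∷ Y)) + α * β * Tot K U) + (- (k * pow q m)) * Tot K U
    totals = begin
        Tot K (WX (X ++ 𝐃 ∷ 𝐄 ∷ Y))
      ≈⟨ Tot-cong K (relationA-row hyp X Y) ⟩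
        Tot K ((q · WX (X ++ 𝐄 ∷ 𝐃 ∷ Y) ⊕ (α * β) · U) ⊕ (- k) · (pow q m · shiftʲ U))
      ≈⟨ Tot-combination K _ _ _ _ _ _ ⟩
        (q * Tot K (WX (X ++ 𝐄 ∷ 𝐃 ∷ Y)) + α * β * Tot K U) + (- k) * Tot K (pow q m · shiftʲ U)
      ≈⟨ +-congˡ (*-congˡ (≈-trans (Tot-· K _ _) (*-congˡ (Tot-window-shiftʲ supp-U)))) ⟩
        (q * Tot K (WX (X ++ 𝐄 ∷ 𝐃 ∷ Y)) + α * β * Tot K U) + (- k) * (pow q m * Tot K U)
      ≈⟨ +-congˡ (≈-trans (≈-sym (*-assoc _ _ _)) (*-congʳ (≈-sym (-‿distribˡ-* k _)))) ⟩
        (q * Tot K (WX (X ++ 𝐄 ∷ 𝐃 ∷ Y)) + α * β * Tot K U) + (- (k * pow q m)) * Tot K U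
      ∎
      where
      supp-U : Supp (L ℕ.* L) L U
      supp-U = supp-⊕ (WX-support (X ++ 𝐃 ∷ Y) |X₁Y|≤L) (WX-support (X ++ 𝐄 ∷ Y) |X₁Y|≤L)

proposition6p8 : ∀ {c ℓ' : Level} (R : CommutativeRing c ℓ')
    (α β γ δ q : CommutativeRing.Carrier R) →
    let open Matrix R α β γ δ q
    in
    (((X : List Letter) (j l : ℕ) →
        WX (X ++ 𝐃 ∷ 𝐄 ∷ []) j l
          ≈ (q * WX (X ++ 𝐄 ∷ 𝐃 ∷ []) j l
             + α * β * (WX (X ++ 𝐃 ∷ []) j l + WX (X ++ 𝐄 ∷ []) j l))
            ⊖ γ * δ * pow q (length X +ᴺ 1)
                * (WXprev (X ++ 𝐃 ∷ []) j l + WXprev (X ++ 𝐄 ∷ []) j l))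
      → (X Y : List Letter) →
        WXV (X ++ 𝐃 ∷ 𝐄 ∷ Y) ⊖ q * WXV (X ++ 𝐄 ∷ 𝐃 ∷ Y)
          ≈ lam (length X +ᴺ length Y +ᴺ 2)
              * (WXV (X ++ 𝐃 ∷ Y) + WXV (X ++ 𝐄 ∷ Y)))
    ×
    (((X : List Letter) (j l : ℕ) →
        β * WX (X ++ 𝐃 ∷ []) j l
          ≈ (δ * WXprev (X ++ 𝐄 ∷ []) j l + α * β * WXprevℓ X j l)
            ⊖ γ * δ * pow q (length X) * WXprev2 X j l)
      → (X : List Letter) →
        β * WXV (X ++ 𝐃 ∷ []) ⊖ δ * WXV (X ++ 𝐄 ∷ [])
          ≈ lam (length X +ᴺ 1) * WXV X)
proposition6p8 R α β γ δ q = Proof.partA R α β γ δ q , Proof.partB R α β γ δ q
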